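{- Let $n\ge 1$. There is a bijection between the set of merging-free partitions of $[n]$ and the set $T_n$ of restricted growth functions $f=f_1f_2\cdots f_n$ over $[n]$ satisfying the following condition: for every $i\in\operatorname{LrMax}(f)$ with $f_i=s>1$, there exists $j>i$ with $f_j=s-1$.
   Context: $[n]=\{1,\dots,n\}$. A set partition of $[n]$ is written in block representation $P=B_1/\cdots/B_k$: the blocks are nonempty, disjoint, cover $[n]$, and $\min B_1<\min B_2<\cdots<\min B_k$. $P$ is merging-free if $\max(B_i)>\min(B_{i+1})$ for all $1\le i\le k-1$. A restricted growth function (RGF) over $[n]$ is a word $f=f_1\cdots f_n$ with $f_1=1$ and $f_i\le 1+\max\{f_1,\dots,f_{i-1}\}$ for $2\le i\le n$. $\operatorname{LrMax}(f)=\{i\in[n]: f_i>f_j \text{ for all } j<i\}$ (left-to-right maxima positions); the letter $f_i$ for $i\in\operatorname{LrMax}(f)$ is called a left-to-right maximum letter. -}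

module Defs where

open import Data.Nat using (ℕ; zero; suc; _∸_; _≤ᵇ_; _<ᵇ_; _≡ᵇ_; _⊔_)
open import Data.Bool using (Bool; true; false; _∧_; if_then_else_; T)
open import Data.List using (List; []; _∷_; concat; upTo; map; length)
open import Data.Bool.ListAction using (any; all)
open import Data.Vec using (Vec; toList)
open import Data.Product using (Σ; _×_)

-- All conditions are Bool-valued so that the subtypes below are
-- proof-irrelevant (T b is a proposition), making "bijection" meaningful.

incr : List ℕ → Bool
incr [] = true
incr (x ∷ []) = true
incr (x ∷ y ∷ ys) = (x <ᵇ y) ∧ incr (y ∷ ys)

inRange : ℕ → ℕ → Bool
inRange n x = (1 ≤ᵇ x) ∧ (x ≤ᵇ n)

nonempty : List ℕ → Bool
nonempty [] = false
nonempty (_ ∷ _) = true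

isBlock : ℕ → List ℕ → Bool
isBlock n b = nonempty b ∧ incr b ∧ all (inRange n) b

count : ℕ → List ℕ → ℕ
count x [] = 0
count x (y ∷ ys) = if x ≡ᵇ y then suc (count x ys) else count x ys

headsIncr : List (List ℕ) → Bool
headsIncr [] = true
headsIncr (_ ∷ []) = true
headsIncr ([] ∷ _ ∷ _) = false
headsIncr ((_ ∷ _) ∷ [] ∷ _) = false
headsIncr ((x ∷ xs) ∷ (y ∷ ys) ∷ bs) = (x <ᵇ y) ∧ headsIncr ((y ∷ ys) ∷ bs)

-- block representation B_1/.../B_k of a set partition of [n]:
-- blocks nonempty subsets of [n], pairwise disjoint and covering [n]
-- (every element of [n] occurs exactly once), min B_1 < ... < min B_k
isSetPartition : ℕ → List (List ℕ) → Bool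
isSetPartition n bs =
  all (isBlock n) bs ∧
  all (λ x → count x (concat bs) ≡ᵇ 1) (map suc (upTo n)) ∧
  headsIncr bs

lastOf : ℕ → List ℕ → ℕ
lastOf d [] = d
lastOf d (x ∷ xs) = lastOf x xs

-- max(B_i) > min(B_{i+1}) for all consecutive blocks
mergingFreeB : List (List ℕ) → Bool
mergingFreeB [] = true
mergingFreeB (_ ∷ []) = true
mergingFreeB (b ∷ [] ∷ bs) = false
mergingFreeB (b ∷ (y ∷ ys) ∷ bs) = (y <ᵇ lastOf 0 b) ∧ mergingFreeB ((y ∷ ys) ∷ bs)

MergingFreePartition : ℕ → Set
MergingFreePartition n =
  Σ (List (List ℕ)) (λ bs → T (isSetPartition n bs) × T (mergingFreeB bs))

rgfGo : ℕ → List ℕ → Bool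
rgfGo m [] = true
rgfGo m (x ∷ xs) = (1 ≤ᵇ x) ∧ (x ≤ᵇ suc m) ∧ rgfGo (m ⊔ x) xs

isRGF : List ℕ → Bool
isRGF [] = true
isRGF (x ∷ xs) = (x ≡ᵇ 1) ∧ rgfGo x xs

condGo : ℕ → List ℕ → Bool
condGo m [] = true
condGo m (x ∷ xs) =
  (if (m <ᵇ x) ∧ (1 <ᵇ x) then any (λ y → y ≡ᵇ (x ∸ 1)) xs else true)
  ∧ condGo (m ⊔ x) xs

TSet : ℕ → Set
TSet n = Σ (Vec ℕ n) (λ f → T (isRGF (toList f)) × T (condGo 0 (toList f)))

-- A partition B₁/⋯/Bₖ of [n] is encoded by the restricted growth function whose i-th letter is
-- the index of the block containing i; conversely a restricted growth function is decoded into
-- its level sets, the s-th block being the set of positions carrying the letter s. In an RGF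
-- the first occurrence of s is precisely the left-to-right maximum with letter s, and it is the
-- minimum of Bₛ, while the maximum of Bₛ₋₁ is the last occurrence of s − 1. Hence the
-- merging-free condition max Bₛ₋₁ > min Bₛ says exactly that s − 1 occurs after the
-- left-to-right maximum s, and encoding and decoding restrict to mutually inverse maps
-- between merging-free partitions and Tₙ.
module Submission where

open import Defs
open import Data.Nat
  using (ℕ; zero; suc; _+_; _∸_; _≤_; _<_; _≤ᵇ_; _<ᵇ_; _≡ᵇ_; _⊔_; z≤n; s≤s; z<s; s<s; s≤s⁻¹)
open import Data.Nat.Properties
open import Data.Bool using (Bool; true; false; _∧_; if_then_else_; T)
open import Data.Bool.Properties using (T-∧; T-irrelevant)
open import Data.Bool.ListAction using (all; any)
open import Data.List using (List; []; _∷_; _++_; concat; map; length; upTo; applyUpTo)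
open import Data.List.Properties using (map-upTo; length-applyUpTo)
open import Data.List.Relation.Unary.All as All using (All; []; _∷_)
open import Data.List.Relation.Unary.All.Properties using (all⁺; all⁻; applyUpTo⁺₁; applyUpTo⁻)
open import Data.List.Relation.Unary.Any using (Any; here; there)
open import Data.List.Relation.Unary.Any.Properties using (any⁺; any⁻)
open import Data.List.Membership.Propositional using (_∈_; _∉_)
open import Data.List.Membership.DecPropositional _≟_ using (_∈?_)
open import Data.List.Membership.Propositional.Properties using (∈-++⁺ˡ; ∈-++⁺ʳ; ∈-++⁻)
open import Data.Vec using (Vec; toList) renaming ([] to []ᵛ; _∷_ to _∷ᵛ_)
open import Data.Vec.Properties using (toList-injective; length-toList; cast-is-id)
open import Data.Product using (∃-syntax; _×_; _,_; proj₁; proj₂)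
open import Data.Sum using (_⊎_; inj₁; inj₂)
open import Data.Empty using (⊥-elim)
open import Function using (_∘_; _⇔_; Equivalence; mk⇔)
open import Function.Bundles using (_⤖_; mk↔ₛ′)
open import Function.Properties.Inverse using (↔⇒⤖)
open import Relation.Nullary using (yes; no)
open import Relation.Binary.Definitions using (tri<; tri≈; tri>)
open import Relation.Binary.PropositionalEquality

nth : {A : Set} → A → List A → ℕ → A
nth d []       _       = d
nth d (x ∷ xs) zero    = x
nth d (x ∷ xs) (suc t) = nth d xs t

infixl 9 _!_
_!_ : List ℕ → ℕ → ℕ
f ! t = nth 0 f t

infixl 9 _‼_
_‼_ : List (List ℕ) → ℕ → List ℕ
bs ‼ j = nth [] bs j

nth-applyUpTo : ∀ {A : Set} (d : A) g {n t} → t < n → nth d (applyUpTo g n) t ≡ g t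
nth-applyUpTo d g {t = zero}  z<s       = refl
nth-applyUpTo d g {t = suc t} (s<s t<n) = nth-applyUpTo d (g ∘ suc) t<n

applyUpTo-nth : ∀ {A : Set} (d : A) {g} xs →
                (∀ {t} → t < length xs → g t ≡ nth d xs t) → applyUpTo g (length xs) ≡ xs
applyUpTo-nth d []       _  = refl
applyUpTo-nth d (x ∷ xs) eq = cong₂ _∷_ (eq z<s) (applyUpTo-nth d xs (eq ∘ s<s))

All-nth : ∀ {A : Set} {P : A → Set} (d : A) {xs t} → All P xs → t < length xs → P (nth d xs t)
All-nth d {t = zero}  (p ∷ _)  _         = p
All-nth d {t = suc t} (_ ∷ ps) (s<s t<n) = All-nth d ps t<n

Any⇒nth : ∀ {A : Set} {P : A → Set} (d : A) {xs} → Any P xs → ∃[ u ] u < length xs × P (nth d xs u)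
Any⇒nth d (here p)  = 0 , z<s , p
Any⇒nth d (there p) with u , u<n , q ← Any⇒nth d p = suc u , s<s u<n , q

nth⇒Any : ∀ {A : Set} {P : A → Set} (d : A) {xs u} → u < length xs → P (nth d xs u) → Any P xs
nth⇒Any d {_ ∷ _} {zero}  _         p = here p
nth⇒Any d {_ ∷ _} {suc u} (s<s u<n) p = there (nth⇒Any d u<n p)

∈nth⇒∈concat : ∀ {x} bs {j} → j < length bs → x ∈ bs ‼ j → x ∈ concat bs
∈nth⇒∈concat (b ∷ bs) {zero}  _         x∈ = ∈-++⁺ˡ x∈
∈nth⇒∈concat (b ∷ bs) {suc j} (s<s j<n) x∈ = ∈-++⁺ʳ b (∈nth⇒∈concat bs j<n x∈)

∈concat⇒∈nth : ∀ {x} bs → x ∈ concat bs → ∃[ j ] j < length bs × x ∈ bs ‼ j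
∈concat⇒∈nth (b ∷ bs) x∈ with ∈-++⁻ b x∈
... | inj₁ x∈b = 0 , z<s , x∈b
... | inj₂ x∈bs with j , j<n , x∈bⱼ ← ∈concat⇒∈nth bs x∈bs = suc j , s<s j<n , x∈bⱼ

maximum : List ℕ → ℕ
maximum []       = 0
maximum (x ∷ xs) = x ⊔ maximum xs

!≤maximum : ∀ xs {t} → t < length xs → xs ! t ≤ maximum xs
!≤maximum (x ∷ xs) {zero}  _         = m≤m⊔n x (maximum xs)
!≤maximum (x ∷ xs) {suc t} (s<s t<n) = ≤-trans (!≤maximum xs t<n) (m≤n⊔m x (maximum xs))

maximum-≤ : ∀ xs {c} → (∀ {t} → t < length xs → xs ! t ≤ c) → maximum xs ≤ c
maximum-≤ []       _   = z≤n
maximum-≤ (x ∷ xs) ≤c = ⊔-lub (≤c z<s) (maximum-≤ xs (≤c ∘ s<s))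

maximum-attained : ∀ xs → 0 < maximum xs → ∃[ t ] t < length xs × xs ! t ≡ maximum xs
maximum-attained (x ∷ xs) 0<max with ⊔-sel x (maximum xs)
... | inj₁ x⊔m≡x = 0 , z<s , sym x⊔m≡x
... | inj₂ x⊔m≡m with t , t<n , eq ← maximum-attained xs (subst (0 <_) x⊔m≡m 0<max) =
  suc t , s<s t<n , trans eq (sym x⊔m≡m)

≡ᵇ-refl : ∀ x → (x ≡ᵇ x) ≡ true
≡ᵇ-refl zero    = refl
≡ᵇ-refl (suc x) = ≡ᵇ-refl x

count-∷-≡ : ∀ x ys → count x (x ∷ ys) ≡ suc (count x ys)
count-∷-≡ x ys rewrite ≡ᵇ-refl x = refl

count-∷-≢ : ∀ {x y} ys → x ≢ y → count x (y ∷ ys) ≡ count x ys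
count-∷-≢ {x} {y} ys x≢y with x ≡ᵇ y in e
... | true  = ⊥-elim (x≢y (≡ᵇ⇒≡ x y (subst T (sym e) _)))
... | false = refl

count-++ : ∀ x xs ys → count x (xs ++ ys) ≡ count x xs + count x ys
count-++ x []       ys = refl
count-++ x (y ∷ xs) ys with x ≟ y
... | yes refl rewrite count-∷-≡ x (xs ++ ys) | count-∷-≡ x xs = cong suc (count-++ x xs ys)
... | no x≢y   rewrite count-∷-≢ (xs ++ ys) x≢y | count-∷-≢ xs x≢y = count-++ x xs ys

count>0⇒∈ : ∀ {x} xs → 0 < count x xs → x ∈ xs
count>0⇒∈ {x} (y ∷ ys) c with x ≟ y
... | yes x≡y = here x≡y
... | no x≢y  = there (count>0⇒∈ ys (subst (0 <_) (count-∷-≢ ys x≢y) c))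

∈⇒count>0 : ∀ {x xs} → x ∈ xs → 0 < count x xs
∈⇒count>0 {x} {_ ∷ ys} (here refl) rewrite count-∷-≡ x ys = z<s
∈⇒count>0 {x} {y ∷ ys} (there x∈ys) with x ≟ y
... | yes refl = subst (0 <_) (sym (count-∷-≡ x ys)) z<s
... | no x≢y   = subst (0 <_) (sym (count-∷-≢ ys x≢y)) (∈⇒count>0 x∈ys)

∉⇒count≡0 : ∀ {x} xs → x ∉ xs → count x xs ≡ 0
∉⇒count≡0 {x} xs x∉xs with count x xs in e
... | zero  = refl
... | suc _ = ⊥-elim (x∉xs (count>0⇒∈ xs (subst (0 <_) (sym e) z<s)))

count-concat-applyUpTo-∉ : ∀ {x} g M → (∀ i → x ∉ g i) → count x (concat (applyUpTo g M)) ≡ 0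
count-concat-applyUpTo-∉         g zero    _    = refl
count-concat-applyUpTo-∉ {x} g (suc M) x∉ =
  trans (count-++ x (g 0) _)
        (cong₂ _+_ (∉⇒count≡0 (g 0) (x∉ 0)) (count-concat-applyUpTo-∉ (g ∘ suc) M (x∉ ∘ suc)))

count-concat-applyUpTo : ∀ {x} g {M j} → j < M → count x (g j) ≡ 1 → (∀ {i} → i ≢ j → x ∉ g i) →
                         count x (concat (applyUpTo g M)) ≡ 1
count-concat-applyUpTo {x} g {suc M} {zero} _ once x∉ =
  trans (count-++ x (g 0) _)
        (cong₂ _+_ once (count-concat-applyUpTo-∉ (g ∘ suc) M (λ i → x∉ {suc i} λ ())))
count-concat-applyUpTo {x} g {suc M} {suc j} (s<s j<M) once x∉ =
  trans (count-++ x (g 0) _)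
        (cong₂ _+_ (∉⇒count≡0 (g 0) (x∉ λ ()))
                   (count-concat-applyUpTo (g ∘ suc) j<M once (x∉ ∘ (_∘ suc-injective))))

incr-∷⁻ : ∀ {x} xs → T (incr (x ∷ xs)) → All (x <_) xs × T (incr xs)
incr-∷⁻         []       _ = [] , _
incr-∷⁻ {x} (y ∷ ys) p with x<y , q ← Equivalence.to (T-∧ {x <ᵇ y}) p with y<ys , _ ← incr-∷⁻ ys q =
  <ᵇ⇒< x y x<y ∷ All.map (<-trans (<ᵇ⇒< x y x<y)) y<ys , q

incr-∷⁺ : ∀ {x xs} → All (x <_) xs → T (incr xs) → T (incr (x ∷ xs))
incr-∷⁺ []          _ = _
incr-∷⁺ (x<y ∷ _) p = Equivalence.from T-∧ (<⇒<ᵇ x<y , p)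

head-≤ : ∀ {x y ys} → All (y <_) ys → x ∈ y ∷ ys → y ≤ x
head-≤ _      (here refl) = ≤-refl
head-≤ y<ys (there x∈ys) = <⇒≤ (All.lookup y<ys x∈ys)

∈-tail : ∀ {x y ys} → x ∈ y ∷ ys → y < x → x ∈ ys
∈-tail (here refl)  y<x = ⊥-elim (<-irrefl refl y<x)
∈-tail (there x∈ys) _   = x∈ys

incr-ext : ∀ {xs ys} → T (incr xs) → T (incr ys) →
           (∀ {z} → z ∈ xs → z ∈ ys) → (∀ {z} → z ∈ ys → z ∈ xs) → xs ≡ ys
incr-ext {[]}     {[]}     _ _ _ _ = refl
incr-ext {[]}     {_ ∷ _}  _ _ _ ⊇ with () ← ⊇ (here refl)
incr-ext {_ ∷ _}  {[]}     _ _ ⊆ _ with () ← ⊆ (here refl)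
incr-ext {x ∷ xs} {y ∷ ys} ix iy ⊆ ⊇
  with x<xs , ixs ← incr-∷⁻ xs ix | y<ys , iys ← incr-∷⁻ ys iy
  with refl ← ≤-antisym (head-≤ y<ys (⊆ (here refl))) (head-≤ x<xs (⊇ (here refl))) =
  cong (x ∷_) (incr-ext ixs iys (λ z∈xs → ∈-tail (⊆ (there z∈xs)) (All.lookup x<xs z∈xs))
                                (λ z∈ys → ∈-tail (⊇ (there z∈ys)) (All.lookup y<ys z∈ys)))

count-incr : ∀ {x} xs → T (incr xs) → x ∈ xs → count x xs ≡ 1
count-incr {x} (y ∷ ys) p x∈ with y<ys , q ← incr-∷⁻ ys p with x ≟ y
... | yes refl =
  trans (count-∷-≡ x ys) (cong suc (∉⇒count≡0 ys (λ x∈ys → <-irrefl refl (All.lookup y<ys x∈ys))))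
... | no x≢y   =
  trans (count-∷-≢ ys x≢y) (count-incr ys q (∈-tail x∈ (≤∧≢⇒< (head-≤ y<ys x∈) (x≢y ∘ sym))))

first : List ℕ → ℕ
first []      = 0
first (x ∷ _) = x

first∈ : ∀ {b} → T (nonempty b) → first b ∈ b
first∈ {_ ∷ _} _ = here refl

first-≤ : ∀ {b y} → T (incr b) → y ∈ b → first b ≤ y
first-≤ {x ∷ xs} p = head-≤ (proj₁ (incr-∷⁻ xs p))

lastOf∈ : ∀ d xs → lastOf d xs ∈ d ∷ xs
lastOf∈ d []       = here refl
lastOf∈ d (x ∷ xs) = there (lastOf∈ x xs)

≤-lastOf : ∀ {d y} xs → T (incr (d ∷ xs)) → y ∈ d ∷ xs → y ≤ lastOf d xs
≤-lastOf []       _ (here refl) = ≤-refl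
≤-lastOf (x ∷ xs) p y∈ with d<xs , q ← incr-∷⁻ (x ∷ xs) p with y∈
... | here refl  = ≤-trans (<⇒≤ (All.lookup d<xs (here refl))) (≤-lastOf xs q (here refl))
... | there y∈xs = ≤-lastOf xs q y∈xs

last∈ : ∀ {b} → T (nonempty b) → lastOf 0 b ∈ b
last∈ {x ∷ xs} _ = lastOf∈ x xs

≤-last : ∀ {b y} → T (incr b) → y ∈ b → y ≤ lastOf 0 b
≤-last {x ∷ xs} = ≤-lastOf xs

∈⇒nonempty : ∀ {x b} → x ∈ b → T (nonempty b)
∈⇒nonempty (here _)  = _
∈⇒nonempty (there _) = _

positionsFrom : ℕ → ℕ → List ℕ → List ℕ
positionsFrom s a []       = []
positionsFrom s a (x ∷ xs) with x ≟ s
... | yes _ = a ∷ positionsFrom s (suc a) xs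
... | no  _ = positionsFrom s (suc a) xs

-- Positions are 1-based, as elements of [n], while indices of _!_ are 0-based:
-- suc t ∈ positions s f exactly when f ! t ≡ s.
positions : ℕ → List ℕ → List ℕ
positions s = positionsFrom s 1

∈-positionsFrom⁻ : ∀ {s a y} xs → y ∈ positionsFrom s a xs →
                   ∃[ t ] y ≡ a + t × t < length xs × xs ! t ≡ s
∈-positionsFrom⁻ {s} {a} (x ∷ xs) y∈ with x ≟ s | y∈
... | yes x≡s | here refl = 0 , sym (+-identityʳ a) , z<s , x≡s
... | yes _   | there y∈′ with t , refl , t<n , eq ← ∈-positionsFrom⁻ xs y∈′ =
  suc t , sym (+-suc a t) , s<s t<n , eq
... | no  _   | y∈′       with t , refl , t<n , eq ← ∈-positionsFrom⁻ xs y∈′ =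
  suc t , sym (+-suc a t) , s<s t<n , eq

∈-positionsFrom⁺ : ∀ {s a t} xs → t < length xs → xs ! t ≡ s → a + t ∈ positionsFrom s a xs
∈-positionsFrom⁺ {s} {a} {zero} (x ∷ xs) _ x≡s with x ≟ s
... | yes _   = here (+-identityʳ a)
... | no  x≢s = ⊥-elim (x≢s x≡s)
∈-positionsFrom⁺ {s} {a} {suc t} (x ∷ xs) (s<s t<n) eq
  with a+t+1∈ ← subst (_∈ positionsFrom s (suc a) xs) (sym (+-suc a t)) (∈-positionsFrom⁺ xs t<n eq)
  with x ≟ s
... | yes _ = there a+t+1∈
... | no  _ = a+t+1∈

∈-positions⁻ : ∀ {s t} f → suc t ∈ positions s f → t < length f × f ! t ≡ s
∈-positions⁻ f t∈ with _ , refl , t<n , ft≡s ← ∈-positionsFrom⁻ f t∈ = t<n , ft≡s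

positionsFrom-incr : ∀ s a xs → T (incr (positionsFrom s a xs))
positionsFrom-incr s a []       = _
positionsFrom-incr s a (x ∷ xs) with x ≟ s
... | yes _ = incr-∷⁺ (All.tabulate above) (positionsFrom-incr s (suc a) xs)
  where
  above : ∀ {y} → y ∈ positionsFrom s (suc a) xs → a < y
  above y∈ with t , refl , _ ← ∈-positionsFrom⁻ xs y∈ = m≤m+n (suc a) t
... | no _ = positionsFrom-incr s (suc a) xs

Adjacent : (List ℕ → List ℕ → Set) → List (List ℕ) → Set
Adjacent R bs = ∀ {j} → suc j < length bs → R (bs ‼ j) (bs ‼ suc j)

Adjacent-applyUpTo⇔ : ∀ {R : List ℕ → List ℕ → Set} g M →
                      Adjacent R (applyUpTo g M) ⇔ (∀ {j} → suc j < M → R (g j) (g (suc j)))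
Adjacent-applyUpTo⇔ {R} g M = mk⇔
  (λ adj {j} j+1<M → subst₂ R (nth-applyUpTo [] g (<-trans (n<1+n j) j+1<M)) (nth-applyUpTo [] g j+1<M)
                          (adj (subst (_ <_) (sym (length-applyUpTo g M)) j+1<M)))
  (λ adj {j} j+1<n → let j+1<M = subst (_ <_) (length-applyUpTo g M) j+1<n in
     subst₂ R (sym (nth-applyUpTo [] g (<-trans (n<1+n j) j+1<M))) (sym (nth-applyUpTo [] g j+1<M))
              (adj j+1<M))

StartsBefore : List ℕ → List ℕ → Set
StartsBefore b c = first b < first c

Overlaps : List ℕ → List ℕ → Set
Overlaps b c = first c < lastOf 0 b

MinimaIncreasing : List (List ℕ) → Set
MinimaIncreasing = Adjacent StartsBefore

MergingFree : List (List ℕ) → Set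
MergingFree = Adjacent Overlaps

headsIncr⁺ : ∀ bs → All (T ∘ nonempty) bs → MinimaIncreasing bs → T (headsIncr bs)
headsIncr⁺ []                          _             _   = _
headsIncr⁺ (_ ∷ [])                    _             _   = _
headsIncr⁺ ([] ∷ _ ∷ _)                (() ∷ _)      _
headsIncr⁺ ((_ ∷ _) ∷ [] ∷ _)          (_ ∷ () ∷ _)  _
headsIncr⁺ ((x ∷ xs) ∷ (y ∷ ys) ∷ bs) (_ ∷ ne)      adj =
  Equivalence.from T-∧ (<⇒<ᵇ (adj (s<s z<s)) , headsIncr⁺ ((y ∷ ys) ∷ bs) ne (adj ∘ s<s))

headsIncr⁻ : ∀ bs → T (headsIncr bs) → MinimaIncreasing bs
headsIncr⁻ (_ ∷ []) _ (s<s ())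
headsIncr⁻ ((x ∷ xs) ∷ (y ∷ ys) ∷ bs) h {zero}  _ = <ᵇ⇒< x y (proj₁ (Equivalence.to (T-∧ {x <ᵇ y}) h))
headsIncr⁻ ((x ∷ xs) ∷ (y ∷ ys) ∷ bs) h {suc j} (s<s j<n) =
  headsIncr⁻ ((y ∷ ys) ∷ bs) (proj₂ (Equivalence.to (T-∧ {x <ᵇ y}) h)) j<n

mergingFreeB⁺ : ∀ bs → All (T ∘ nonempty) bs → MergingFree bs → T (mergingFreeB bs)
mergingFreeB⁺ []                   _            _   = _
mergingFreeB⁺ (_ ∷ [])             _            _   = _
mergingFreeB⁺ (_ ∷ [] ∷ _)         (_ ∷ () ∷ _) _
mergingFreeB⁺ (b ∷ (y ∷ ys) ∷ bs) (_ ∷ ne)     adj =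
  Equivalence.from T-∧ (<⇒<ᵇ (adj (s<s z<s)) , mergingFreeB⁺ ((y ∷ ys) ∷ bs) ne (adj ∘ s<s))

mergingFreeB⁻ : ∀ bs → T (mergingFreeB bs) → MergingFree bs
mergingFreeB⁻ (_ ∷ []) _ (s<s ())
mergingFreeB⁻ (b ∷ (y ∷ ys) ∷ bs) h {zero} _ =
  <ᵇ⇒< y (lastOf 0 b) (proj₁ (Equivalence.to (T-∧ {y <ᵇ lastOf 0 b}) h))
mergingFreeB⁻ (b ∷ (y ∷ ys) ∷ bs) h {suc j} (s<s j<n) =
  mergingFreeB⁻ ((y ∷ ys) ∷ bs) (proj₂ (Equivalence.to (T-∧ {y <ᵇ lastOf 0 b}) h)) j<n

record IsPartition (n : ℕ) (bs : List (List ℕ)) : Set where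
  field
    nonempty-blocks   : All (T ∘ nonempty) bs
    increasing-blocks : All (T ∘ incr) bs
    bounded-blocks    : All (All (λ y → 1 ≤ y × y ≤ n)) bs
    occurs-once       : ∀ {t} → t < n → count (suc t) (concat bs) ≡ 1
    minima-increasing : MinimaIncreasing bs

inRange⇔ : ∀ {n y} → T (inRange n y) ⇔ (1 ≤ y × y ≤ n)
inRange⇔ {n} {y} = mk⇔
  (λ p → let 1≤ᵇy , y≤ᵇn = Equivalence.to (T-∧ {1 ≤ᵇ y}) p in ≤ᵇ⇒≤ 1 y 1≤ᵇy , ≤ᵇ⇒≤ y n y≤ᵇn)
  (λ (1≤y , y≤n) → Equivalence.from T-∧ (≤⇒≤ᵇ 1≤y , ≤⇒≤ᵇ y≤n))

isBlock⇔ : ∀ {n b} → T (isBlock n b) ⇔ (T (nonempty b) × T (incr b) × All (λ y → 1 ≤ y × y ≤ n) b)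
isBlock⇔ {n} {b} = mk⇔
  (λ p → let ne , rest = Equivalence.to (T-∧ {nonempty b}) p
             inc , bnd = Equivalence.to (T-∧ {incr b}) rest
         in ne , inc , All.map (Equivalence.to inRange⇔) (all⁺ (inRange n) b bnd))
  (λ (ne , inc , bnd) →
    Equivalence.from T-∧ (ne , Equivalence.from T-∧
      (inc , all⁻ (inRange n) (All.map (Equivalence.from inRange⇔) bnd))))

isSetPartition⇔ : ∀ n bs → T (isSetPartition n bs) ⇔ IsPartition n bs
isSetPartition⇔ n bs = mk⇔ sound complete
  where
  once? : ℕ → Bool
  once? x = count x (concat bs) ≡ᵇ 1

  sound : T (isSetPartition n bs) → IsPartition n bs
  sound p = record
    { nonempty-blocks   = All.map proj₁ blocks
    ; increasing-blocks = All.map (proj₁ ∘ proj₂) blocks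
    ; bounded-blocks    = All.map (proj₂ ∘ proj₂) blocks
    ; occurs-once       = λ t<n → ≡ᵇ⇒≡ _ 1 (applyUpTo⁻ suc n counts t<n)
    ; minima-increasing = headsIncr⁻ bs heads
    }
    where
    split₁ = Equivalence.to (T-∧ {all (isBlock n) bs}) p
    split₂ = Equivalence.to (T-∧ {all once? (map suc (upTo n))}) (proj₂ split₁)
    blocks = All.map (Equivalence.to isBlock⇔) (all⁺ (isBlock n) bs (proj₁ split₁))
    counts = subst (All (T ∘ once?)) (map-upTo suc n) (all⁺ once? _ (proj₁ split₂))
    heads  = proj₂ split₂

  complete : IsPartition n bs → T (isSetPartition n bs)
  complete P = Equivalence.from T-∧ (blocks , Equivalence.from T-∧ (counts , heads))
    where
    open IsPartition P
    blocks = all⁻ (isBlock n) (All.map (Equivalence.from isBlock⇔)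
               (All.zip (nonempty-blocks , All.zip (increasing-blocks , bounded-blocks))))
    counts = all⁻ once? (subst (All (T ∘ once?)) (sym (map-upTo suc n))
               (applyUpTo⁺₁ suc n (λ t<n → ≡⇒≡ᵇ _ 1 (occurs-once t<n))))
    heads  = headsIncr⁺ bs nonempty-blocks minima-increasing

PredecessorBefore : List ℕ → ℕ → Set
PredecessorBefore xs t = ∃[ u ] u < t × suc (xs ! u) ≡ xs ! t

PredecessorAfter : List ℕ → ℕ → Set
PredecessorAfter xs t = ∃[ u ] t < u × u < length xs × suc (xs ! u) ≡ xs ! t

-- The letters of a word satisfying rgfGo m leave no gaps above m, so bounding each letter by
-- 1 + the maximum of m and the earlier letters amounts to asking that it be at most m + 1 or
-- that its predecessor occur earlier.
RGFFrom : ℕ → List ℕ → Set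
RGFFrom m xs = ∀ {t} → t < length xs → 1 ≤ xs ! t × (xs ! t ≤ suc m ⊎ PredecessorBefore xs t)

IsRGF : List ℕ → Set
IsRGF = RGFFrom 0

rgfGo-∷⇔ : ∀ m x xs → T (rgfGo m (x ∷ xs)) ⇔ (1 ≤ x × x ≤ suc m × T (rgfGo (m ⊔ x) xs))
rgfGo-∷⇔ m x xs = mk⇔
  (λ p → let 1≤ᵇx , rest = Equivalence.to (T-∧ {1 ≤ᵇ x}) p
             x≤ᵇ1+m , r = Equivalence.to (T-∧ {x ≤ᵇ suc m}) rest
         in ≤ᵇ⇒≤ 1 x 1≤ᵇx , ≤ᵇ⇒≤ x (suc m) x≤ᵇ1+m , r)
  (λ (1≤x , x≤1+m , r) → Equivalence.from T-∧ (≤⇒≤ᵇ 1≤x , Equivalence.from T-∧ (≤⇒≤ᵇ x≤1+m , r)))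

rgfGo⇒RGFFrom : ∀ m xs → T (rgfGo m xs) → RGFFrom m xs
rgfGo⇒RGFFrom m (x ∷ xs) p {zero} _ with 1≤x , x≤1+m , _ ← Equivalence.to (rgfGo-∷⇔ m x xs) p =
  1≤x , inj₁ x≤1+m
rgfGo⇒RGFFrom m (x ∷ xs) p {suc t} (s<s t<n)
  with _ , x≤1+m , r ← Equivalence.to (rgfGo-∷⇔ m x xs) p
  with rgfGo⇒RGFFrom (m ⊔ x) xs r t<n
... | 1≤v , inj₂ (u , u<t , eq) = 1≤v , inj₂ (suc u , s<s u<t , eq)
... | 1≤v , inj₁ v≤1+m⊔x with xs ! t ≤? suc m | ⊔-sel m x
...   | yes v≤1+m | _          = 1≤v , inj₁ v≤1+m
...   | no  v≰1+m | inj₁ m⊔x≡m = ⊥-elim (v≰1+m (subst (λ k → xs ! t ≤ suc k) m⊔x≡m v≤1+m⊔x))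
...   | no  v≰1+m | inj₂ m⊔x≡x =
  1≤v , inj₂ (0 , z<s , ≤-antisym (≤-trans (s≤s x≤1+m) (≰⇒> v≰1+m))
                                  (subst (λ k → xs ! t ≤ suc k) m⊔x≡x v≤1+m⊔x))

RGFFrom⇒rgfGo : ∀ m xs → RGFFrom m xs → T (rgfGo m xs)
RGFFrom⇒rgfGo m []       _ = _
RGFFrom⇒rgfGo m (x ∷ xs) R with R z<s
... | _   , inj₂ (_ , () , _)
... | 1≤x , inj₁ x≤1+m = Equivalence.from (rgfGo-∷⇔ m x xs) (1≤x , x≤1+m , RGFFrom⇒rgfGo (m ⊔ x) xs R′)
  where
  R′ : RGFFrom (m ⊔ x) xs
  R′ t<n with R (s<s t<n)
  ... | 1≤v , inj₁ v≤1+m                  = 1≤v , inj₁ (≤-trans v≤1+m (s≤s (m≤m⊔n m x)))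
  ... | 1≤v , inj₂ (zero , _ , eq)          = 1≤v , inj₁ (subst (_≤ suc (m ⊔ x)) eq (s≤s (m≤n⊔m m x)))
  ... | 1≤v , inj₂ (suc u , s<s u<t , eq) = 1≤v , inj₂ (u , u<t , eq)

isRGF≡rgfGo0 : ∀ f → isRGF f ≡ rgfGo 0 f
isRGF≡rgfGo0 []                  = refl
isRGF≡rgfGo0 (zero ∷ _)          = refl
isRGF≡rgfGo0 (suc zero ∷ _)      = refl
isRGF≡rgfGo0 (suc (suc _) ∷ _)   = refl

isRGF⇔ : ∀ f → T (isRGF f) ⇔ IsRGF f
isRGF⇔ f rewrite isRGF≡rgfGo0 f = mk⇔ (rgfGo⇒RGFFrom 0 f) (RGFFrom⇒rgfGo 0 f)

IsLrMax : List ℕ → ℕ → Set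
IsLrMax xs t = ∀ {u} → u < t → xs ! u < xs ! t

IsLrMax-∷ : ∀ {x xs t} → x < xs ! t → IsLrMax xs t → IsLrMax (x ∷ xs) (suc t)
IsLrMax-∷ x<v _   {zero}  _         = x<v
IsLrMax-∷ _   lrm {suc u} (s<s u<t) = lrm u<t

-- Here m is the largest letter preceding xs, so m < xs ! t and IsLrMax xs t together say that
-- t is a left-to-right maximum of the whole word.
CondFrom : ℕ → List ℕ → Set
CondFrom m xs = ∀ {t} → t < length xs → m < xs ! t → IsLrMax xs t → 1 < xs ! t → PredecessorAfter xs t

Cond : List ℕ → Set
Cond = CondFrom 0

if-true⇔ : ∀ {c a} → T (if c then a else true) ⇔ (T c → T a)
if-true⇔ {true}  = mk⇔ (λ p _ → p) (λ p → p _)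
if-true⇔ {false} = mk⇔ (λ _ ()) (λ _ → _)

condGo⇒CondFrom : ∀ m xs → T (condGo m xs) → CondFrom m xs
condGo⇒CondFrom m (zero ∷ xs) _ {zero} _ _ _ ()
condGo⇒CondFrom m (suc x ∷ xs) p {zero} _ m<x _ 1<x
  with u , u<n , eq ← Any⇒nth 0 (any⁻ _ xs (Equivalence.to if-true⇔ (proj₁ (Equivalence.to T-∧ p))
                                              (Equivalence.from T-∧ (<⇒<ᵇ m<x , <⇒<ᵇ 1<x)))) =
  suc u , z<s , s<s u<n , cong suc (≡ᵇ⇒≡ _ x eq)
condGo⇒CondFrom m (x ∷ xs) p {suc t} (s<s t<n) m<v lrm 1<v
  with u , t<u , u<n , eq ← condGo⇒CondFrom (m ⊔ x) xs (proj₂ (Equivalence.to T-∧ p)) t<n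
                              (⊔-lub m<v (lrm z<s)) (lrm ∘ s<s) 1<v =
  suc u , s<s t<u , s<s u<n , eq

CondFrom⇒condGo : ∀ m xs → CondFrom m xs → T (condGo m xs)
CondFrom⇒condGo m []       _ = _
CondFrom⇒condGo m (x ∷ xs) C =
  Equivalence.from T-∧ (Equivalence.from if-true⇔ predecessor , CondFrom⇒condGo (m ⊔ x) xs C′)
  where
  predecessor : T ((m <ᵇ x) ∧ (1 <ᵇ x)) → T (any (λ y → y ≡ᵇ (x ∸ 1)) xs)
  predecessor c with m<ᵇx , 1<ᵇx ← Equivalence.to (T-∧ {m <ᵇ x}) c
    with C z<s (<ᵇ⇒< m x m<ᵇx) (λ ()) (<ᵇ⇒< 1 x 1<ᵇx)
  ... | suc u , _ , s<s u<n , eq =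
    any⁺ (λ y → y ≡ᵇ (x ∸ 1)) (nth⇒Any 0 {xs} u<n (≡⇒≡ᵇ _ _ (cong (_∸ 1) eq)))

  C′ : CondFrom (m ⊔ x) xs
  C′ t<n m⊔x<v lrm 1<v
    with suc u , s<s t<u , s<s u<n , eq ← C (s<s t<n) (m⊔n<o⇒m<o m x m⊔x<v)
                                            (IsLrMax-∷ (m⊔n<o⇒n<o m x m⊔x<v) lrm) 1<v =
    u , t<u , u<n , eq

condGo⇔ : ∀ f → T (condGo 0 f) ⇔ Cond f
condGo⇔ f = mk⇔ (condGo⇒CondFrom 0 f) (CondFrom⇒condGo 0 f)

blockOf : List (List ℕ) → ℕ → ℕ
blockOf []       x = 0
blockOf (b ∷ bs) x with x ∈? b
... | yes _ = 1
... | no  _ = suc (blockOf bs x)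

blockOf-∈nth : ∀ {x} bs {j} → count x (concat bs) ≡ 1 → j < length bs → x ∈ bs ‼ j →
               blockOf bs x ≡ suc j
blockOf-∈nth {x} (b ∷ bs) {j} once j<n x∈bⱼ with x ∈? b | j | j<n
... | yes _   | zero  | _         = refl
... | no  x∉b | zero  | _         = ⊥-elim (x∉b x∈bⱼ)
... | yes x∈b | suc j | s<s j<n′ = ⊥-elim (<-irrefl refl twice)
  where
  twice : 1 < 1
  twice = subst (1 <_) (trans (sym (count-++ x b (concat bs))) once)
            (+-mono-≤ (∈⇒count>0 x∈b) (∈⇒count>0 (∈nth⇒∈concat bs j<n′ x∈bⱼ)))
... | no  x∉b | suc j | s<s j<n′ = cong suc (blockOf-∈nth bs once-in-rest j<n′ x∈bⱼ)
  where
  once-in-rest : count x (concat bs) ≡ 1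
  once-in-rest = trans (cong (_+ count x (concat bs)) (sym (∉⇒count≡0 b x∉b)))
                     (trans (sym (count-++ x b (concat bs))) once)

encode : List (List ℕ) → ℕ → List ℕ
encode bs n = applyUpTo (blockOf bs ∘ suc) n

decode : List ℕ → List (List ℕ)
decode f = applyUpTo (λ j → positions (suc j) f) (maximum f)

module RGFProperties (f : List ℕ) (rgf : IsRGF f) where

  letter-before′ : ∀ {s} k {t} → t < length f → 1 ≤ s → f ! t ≡ s + suc k → ∃[ u ] u < t × f ! u ≡ s
  letter-before′ {s} k t<n 1≤s eq with rgf t<n
  ... | _ , inj₁ v≤1 =
    ⊥-elim (<-irrefl refl (≤-trans (subst (2 ≤_) (sym eq) (+-mono-≤ 1≤s (s≤s z≤n))) v≤1))
  ... | _ , inj₂ (u , u<t , 1+fu≡v) with k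
  ...   | zero   = u , u<t , suc-injective (trans 1+fu≡v (trans eq (+-comm s 1)))
  ...   | suc k′ with u′ , u′<u , fu′≡s ← letter-before′ k′ (<-trans u<t t<n) 1≤s
                                           (suc-injective (trans 1+fu≡v (trans eq (+-suc s (suc k′))))) =
    u′ , <-trans u′<u u<t , fu′≡s

  letter-before : ∀ {s t} → t < length f → 1 ≤ s → s < f ! t → ∃[ u ] u < t × f ! u ≡ s
  letter-before {s} t<n 1≤s s<v with k , eq ← m≤n⇒∃[o]m+o≡n s<v =
    letter-before′ k t<n 1≤s (trans (sym eq) (sym (+-suc s k)))

  letter-occurs : ∀ {s} → 1 ≤ s → s ≤ maximum f → ∃[ t ] t < length f × f ! t ≡ s
  letter-occurs {s} 1≤s s≤max
    with t , t<n , v≡max ← maximum-attained f (≤-trans 1≤s s≤max) | m≤n⇒m<n∨m≡n s≤max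
  ... | inj₂ refl = t , t<n , v≡max
  ... | inj₁ s<max with u , u<t , fu≡s ← letter-before t<n 1≤s (subst (s <_) (sym v≡max) s<max) =
    u , <-trans u<t t<n , fu≡s

  positions-nonempty : ∀ {s} → 1 ≤ s → s ≤ maximum f → T (nonempty (positions s f))
  positions-nonempty 1≤s s≤max with _ , t<n , ft≡s ← letter-occurs 1≤s s≤max =
    ∈⇒nonempty (∈-positionsFrom⁺ f t<n ft≡s)

  first-positions : ∀ {s} → 1 ≤ s → s ≤ maximum f →
                    ∃[ t ] first (positions s f) ≡ suc t × t < length f × f ! t ≡ s
  first-positions 1≤s s≤max = ∈-positionsFrom⁻ f (first∈ (positions-nonempty 1≤s s≤max))

  first-positions-≤ : ∀ {s t} → t < length f → f ! t ≡ s → first (positions s f) ≤ suc t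
  first-positions-≤ t<n ft≡s = first-≤ (positionsFrom-incr _ 1 f) (∈-positionsFrom⁺ f t<n ft≡s)

  first-positions-increasing : ∀ {s v} → 1 ≤ s → s < v → v ≤ maximum f →
                               first (positions s f) < first (positions v f)
  first-positions-increasing 1≤s s<v v≤max
    with t , first≡ , t<n , ft≡v ← first-positions (≤-trans 1≤s (<⇒≤ s<v)) v≤max
    with u , u<t , fu≡s ← letter-before t<n 1≤s (subst (_ <_) (sym ft≡v) s<v) =
    ≤-<-trans (first-positions-≤ (<-trans u<t t<n) fu≡s) (subst (suc u <_) (sym first≡) (s<s u<t))

  not-before-first : ∀ {v t u} → t < length f → first (positions v f) ≡ suc t → u < t → f ! u ≢ v
  not-before-first t<n first≡ u<t fu≡v =
    <⇒≱ (s<s u<t) (subst (_≤ _) first≡ (first-positions-≤ (<-trans u<t t<n) fu≡v))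

  first-occurrence-LrMax : ∀ {v t} → 1 ≤ v → t < length f → first (positions v f) ≡ suc t → f ! t ≡ v →
                           IsLrMax f t
  first-occurrence-LrMax {v} 1≤v t<n first≡ ft≡v {u} u<t with <-cmp (f ! u) v
  ... | tri< fu<v _ _ = subst (f ! u <_) (sym ft≡v) fu<v
  ... | tri≈ _ fu≡v _ = ⊥-elim (not-before-first t<n first≡ u<t fu≡v)
  ... | tri> _ _ v<fu with w , w<u , fw≡v ← letter-before (<-trans u<t t<n) 1≤v v<fu =
    ⊥-elim (not-before-first t<n first≡ (<-trans w<u u<t) fw≡v)

  decode-occurs-once : ∀ {t} → t < length f → count (suc t) (concat (decode f)) ≡ 1
  decode-occurs-once {t} t<n with f ! t in ft | rgf t<n | !≤maximum f t<n
  ... | suc j | _ | j<max =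
    count-concat-applyUpTo (λ i → positions (suc i) f) j<max
      (count-incr _ (positionsFrom-incr _ 1 f) (∈-positionsFrom⁺ f t<n ft))
      (λ i≢j t∈ → i≢j (suc-injective (trans (sym (proj₂ (∈-positions⁻ f t∈))) ft)))

  decode-partition : IsPartition (length f) (decode f)
  decode-partition = record
    { nonempty-blocks   = applyUpTo⁺₁ _ (maximum f) (positions-nonempty (s≤s z≤n))
    ; increasing-blocks = applyUpTo⁺₁ _ (maximum f) (λ _ → positionsFrom-incr _ 1 f)
    ; bounded-blocks    = applyUpTo⁺₁ _ (maximum f) (λ _ → All.tabulate bounded)
    ; occurs-once       = decode-occurs-once
    ; minima-increasing = Equivalence.from (Adjacent-applyUpTo⇔ {R = StartsBefore} _ (maximum f))
                            (first-positions-increasing (s≤s z≤n) ≤-refl)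
    }
    where
    bounded : ∀ {s y} → y ∈ positions s f → 1 ≤ y × y ≤ length f
    bounded y∈ with _ , refl , t<n , _ ← ∈-positionsFrom⁻ f y∈ = s≤s z≤n , t<n

  Interleaved : Set
  Interleaved = ∀ {j} → suc j < maximum f → Overlaps (positions (1 + j) f) (positions (2 + j) f)

  Cond⇒Interleaved : Cond f → Interleaved
  Cond⇒Interleaved cond j+1<max
    with t , first≡ , t<n , ft≡v ← first-positions (s≤s z≤n) j+1<max
    with u , t<u , u<n , 1+fu≡v ← cond t<n (subst (0 <_) (sym ft≡v) z<s)
                                       (first-occurrence-LrMax (s≤s z≤n) t<n first≡ ft≡v)
                                       (subst (1 <_) (sym ft≡v) (s<s z<s)) =
    <-≤-trans (subst (_< suc u) (sym first≡) (s<s t<u))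
              (≤-last (positionsFrom-incr _ 1 f)
                      (∈-positionsFrom⁺ f u<n (suc-injective (trans 1+fu≡v ft≡v))))

  Interleaved⇒Cond : Interleaved → Cond f
  Interleaved⇒Cond il {t} t<n _ lrm 1<v with f ! t in ft | !≤maximum f t<n
  ... | zero        | _ = ⊥-elim (n≮0 1<v)
  ... | suc zero    | _ = ⊥-elim (<-irrefl refl 1<v)
  ... | suc (suc j) | j+1<max
    with t₀ , first≡ , _ , ft₀ ← first-positions (s≤s z≤n) j+1<max
    with t₁ , last≡ , t₁<n , ft₁ ←
           ∈-positionsFrom⁻ f (last∈ (positions-nonempty (s≤s z≤n) (<⇒≤ j+1<max))) =
    t₁ , t<t₁ , t₁<n , cong suc ft₁
    where
    t≤t₀ : t ≤ t₀
    t≤t₀ = ≮⇒≥ (λ t₀<t → <-irrefl ft₀ (lrm t₀<t))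
    t<t₁ : t < t₁
    t<t₁ = s≤s⁻¹ (≤-<-trans (s≤s t≤t₀) (subst₂ _<_ first≡ last≡ (il j+1<max)))

  decode-mergingFree⇔ : MergingFree (decode f) ⇔ Cond f
  decode-mergingFree⇔ =
    mk⇔ (Interleaved⇒Cond ∘ Equivalence.to adjacent) (Equivalence.from adjacent ∘ Cond⇒Interleaved)
    where adjacent = Adjacent-applyUpTo⇔ {R = Overlaps} (λ j → positions (suc j) f) (maximum f)

  encode-decode : encode (decode f) (length f) ≡ f
  encode-decode = applyUpTo-nth 0 f blockOf-decode
    where
    blockOf-decode : ∀ {t} → t < length f → blockOf (decode f) (suc t) ≡ f ! t
    blockOf-decode {t} t<n with f ! t in ft | rgf t<n | !≤maximum f t<n
    ... | suc j | _ | j<max =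
      blockOf-∈nth (decode f) (decode-occurs-once t<n)
        (subst (j <_) (sym (length-applyUpTo _ (maximum f))) j<max)
        (subst (suc t ∈_) (sym (nth-applyUpTo [] _ j<max)) (∈-positionsFrom⁺ f t<n ft))

module PartitionProperties (n : ℕ) (bs : List (List ℕ)) (P : IsPartition n bs) where
  open IsPartition P

  ∈-block : ∀ {j t} → j < length bs → suc t ∈ bs ‼ j → t < n × blockOf bs (suc t) ≡ suc j
  ∈-block j<L t∈ with _ , t<n ← All.lookup (All-nth [] bounded-blocks j<L) t∈ =
    t<n , blockOf-∈nth bs (occurs-once t<n) j<L t∈

  first-block : ∀ {j} → j < length bs →
                ∃[ t ] first (bs ‼ j) ≡ suc t × t < n × blockOf bs (suc t) ≡ suc j
  first-block {j} j<L with first (bs ‼ j) | first∈ (All-nth [] nonempty-blocks j<L)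
  ... | zero  | 0∈ with () , _ ← All.lookup (All-nth [] bounded-blocks j<L) 0∈
  ... | suc t | t∈ = t , refl , ∈-block j<L t∈

  ∈-some-block : ∀ {t} → t < n → ∃[ j ] j < length bs × suc t ∈ bs ‼ j × blockOf bs (suc t) ≡ suc j
  ∈-some-block t<n
    with j , j<L , t∈ ← ∈concat⇒∈nth bs (count>0⇒∈ (concat bs) (subst (0 <_) (sym (occurs-once t<n)) z<s)) =
    j , j<L , t∈ , blockOf-∈nth bs (occurs-once t<n) j<L t∈

  encode-! : ∀ {t} → t < n → encode bs n ! t ≡ blockOf bs (suc t)
  encode-! = nth-applyUpTo 0 _

  length-encode : length (encode bs n) ≡ n
  length-encode = length-applyUpTo _ n

  maximum-encode : maximum (encode bs n) ≡ length bs
  maximum-encode = ≤-antisym (maximum-≤ (encode bs n) at-most-blocks) at-least-blocks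
    where
    at-most-blocks : ∀ {t} → t < length (encode bs n) → encode bs n ! t ≤ length bs
    at-most-blocks t<len with t<n ← subst (_ <_) length-encode t<len
      with _ , j<L , _ , blockOf≡ ← ∈-some-block t<n =
      subst (_≤ length bs) (sym (trans (encode-! t<n) blockOf≡)) j<L
    at-least-blocks : length bs ≤ maximum (encode bs n)
    at-least-blocks with length bs in L≡
    ... | zero  = z≤n
    ... | suc j with t , _ , t<n , blockOf≡ ← first-block (subst (j <_) (sym L≡) ≤-refl) =
      subst (_≤ maximum (encode bs n)) (trans (encode-! t<n) blockOf≡)
            (!≤maximum (encode bs n) (subst (t <_) (sym length-encode) t<n))

  encode-RGF : IsRGF (encode bs n)
  encode-RGF {t} t<len
    with t<n ← subst (_ <_) length-encode t<len
    with j , j<L , t∈ , blockOf≡ ← ∈-some-block t<n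
    with j | trans (encode-! t<n) blockOf≡
  ... | zero   | v≡ = subst (1 ≤_) (sym v≡) (s≤s z≤n) , inj₁ (≤-reflexive v≡)
  ... | suc j′ | v≡ with t′ , first≡ , t′<n , blockOf′≡ ← first-block (<-trans (n<1+n j′) j<L) =
    subst (1 ≤_) (sym v≡) (s≤s z≤n) ,
    inj₂ (t′ , t′<t , trans (cong suc (trans (encode-! t′<n) blockOf′≡)) (sym v≡))
    where
    t′<t : t′ < t
    t′<t = s≤s⁻¹ (<-≤-trans (subst (_< first (bs ‼ suc j′)) first≡ (minima-increasing j<L))
                            (first-≤ (All-nth [] increasing-blocks j<L) t∈))

  positions-encode : ∀ {j} → j < length bs → positions (suc j) (encode bs n) ≡ bs ‼ j
  positions-encode {j} j<L =
    incr-ext (positionsFrom-incr (suc j) 1 (encode bs n)) (All-nth [] increasing-blocks j<L) ⊆ ⊇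
    where
    ⊆ : ∀ {y} → y ∈ positions (suc j) (encode bs n) → y ∈ bs ‼ j
    ⊆ y∈ with t , refl , t<len , enc≡ ← ∈-positionsFrom⁻ (encode bs n) y∈
      with t<n ← subst (_ <_) length-encode t<len
      with j′ , _ , t∈ , blockOf≡ ← ∈-some-block t<n
      with refl ← suc-injective (trans (sym blockOf≡) (trans (sym (encode-! t<n)) enc≡)) = t∈
    ⊇ : ∀ {y} → y ∈ bs ‼ j → y ∈ positions (suc j) (encode bs n)
    ⊇ {zero}  0∈ with () , _ ← All.lookup (All-nth [] bounded-blocks j<L) 0∈
    ⊇ {suc t} t∈ with t<n , blockOf≡ ← ∈-block j<L t∈ =
      ∈-positionsFrom⁺ (encode bs n) (subst (t <_) (sym length-encode) t<n)
                       (trans (encode-! t<n) blockOf≡)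

  decode-encode : decode (encode bs n) ≡ bs
  decode-encode rewrite maximum-encode = applyUpTo-nth [] bs positions-encode

applyUpToᵛ : (ℕ → ℕ) → (n : ℕ) → Vec ℕ n
applyUpToᵛ g zero    = []ᵛ
applyUpToᵛ g (suc n) = g 0 ∷ᵛ applyUpToᵛ (g ∘ suc) n

toList-applyUpToᵛ : ∀ g n → toList (applyUpToᵛ g n) ≡ applyUpTo g n
toList-applyUpToᵛ g zero    = refl
toList-applyUpToᵛ g (suc n) = cong (g 0 ∷_) (toList-applyUpToᵛ (g ∘ suc) n)

Σ-T-≡ : ∀ {A : Set} {p q : A → Bool} {a a′ : A} {x : T (p a) × T (q a)} {y : T (p a′) × T (q a′)} →
        a ≡ a′ → _≡_ {A = ∃[ a ] T (p a) × T (q a)} (a , x) (a′ , y)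
Σ-T-≡ {x = x₁ , x₂} {y = y₁ , y₂} refl rewrite T-irrelevant x₁ y₁ | T-irrelevant x₂ y₂ = refl

toList-injective′ : ∀ {n} {xs ys : Vec ℕ n} → toList xs ≡ toList ys → xs ≡ ys
toList-injective′ {xs = xs} {ys} eq = trans (sym (cast-is-id refl xs)) (toList-injective refl xs ys eq)

module _ (n : ℕ) where

  encodeᵛ : List (List ℕ) → Vec ℕ n
  encodeᵛ bs = applyUpToᵛ (blockOf bs ∘ suc) n

  toList-encodeᵛ : ∀ bs → toList (encodeᵛ bs) ≡ encode bs n
  toList-encodeᵛ bs = toList-applyUpToᵛ (blockOf bs ∘ suc) n

  toTSet : MergingFreePartition n → TSet n
  toTSet (bs , sp , mf) =
    encodeᵛ bs ,
    subst (T ∘ isRGF) (sym (toList-encodeᵛ bs)) (Equivalence.from (isRGF⇔ (encode bs n)) encode-RGF) ,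
    subst (T ∘ condGo 0) (sym (toList-encodeᵛ bs)) (Equivalence.from (condGo⇔ (encode bs n)) cond)
    where
    open PartitionProperties n bs (Equivalence.to (isSetPartition⇔ n bs) sp)

    cond : Cond (encode bs n)
    cond = Equivalence.to (RGFProperties.decode-mergingFree⇔ (encode bs n) encode-RGF)
                          (subst MergingFree (sym decode-encode) (mergingFreeB⁻ bs mf))

  fromTSet : TSet n → MergingFreePartition n
  fromTSet (f , r , c) =
    decode (toList f) ,
    subst (λ k → T (isSetPartition k (decode (toList f)))) (length-toList f)
      (Equivalence.from (isSetPartition⇔ _ _) decode-partition) ,
    mergingFreeB⁺ _ (IsPartition.nonempty-blocks decode-partition)
      (Equivalence.from decode-mergingFree⇔ (Equivalence.to (condGo⇔ (toList f)) c))
    where open RGFProperties (toList f) (Equivalence.to (isRGF⇔ (toList f)) r)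

  toTSet∘fromTSet : ∀ y → toTSet (fromTSet y) ≡ y
  toTSet∘fromTSet (f , r , c) = Σ-T-≡ (toList-injective′ (begin
    toList (encodeᵛ (decode (toList f)))           ≡⟨ toList-encodeᵛ (decode (toList f)) ⟩
    encode (decode (toList f)) n                   ≡⟨ cong (encode (decode (toList f))) (sym (length-toList f)) ⟩
    encode (decode (toList f)) (length (toList f)) ≡⟨ encode-decode ⟩
    toList f                                       ∎))
    where
    open ≡-Reasoning
    open RGFProperties (toList f) (Equivalence.to (isRGF⇔ (toList f)) r)

  fromTSet∘toTSet : ∀ x → fromTSet (toTSet x) ≡ x
  fromTSet∘toTSet (bs , sp , mf) = Σ-T-≡ (trans (cong decode (toList-encodeᵛ bs)) decode-encode)
    where open PartitionProperties n bs (Equivalence.to (isSetPartition⇔ n bs) sp)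

proposition12 : (n : ℕ) → 1 ≤ n → MergingFreePartition n ⤖ TSet n
proposition12 n _ = ↔⇒⤖ (mk↔ₛ′ (toTSet n) (fromTSet n) (toTSet∘fromTSet n) (fromTSet∘toTSet n))
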